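{- Let $G$ be the intersection graph of a family of $n$ intervals in NIR form, with vertices $v_1,\dots,v_n$, where $v_i$ corresponds to the interval $[i-1,b_i)$, and let $H_G$ be its NIR matrix. For each row index $i\in\{1,\dots,n\}$ let $R_i=\{j<i: H_G(i,j)=1\}\cup\{i\}$. Call row $i$ special if either $i=n$, or there exists $j\in R_i$ with $H_G(i+1,j)=0$. Then the map sending a special row $i$ to the vertex set $\{v_j: j\in R_i\}$ is a bijection from the set of special rows of $H_G$ onto the set of maximal cliques of $G$.
   Context: A family of $n$ intervals is in NIR form if every interval is of the form $[i,j)$ with integers $0\le i<j\le n$, and for every $i\in\{0,\dots,n-1\}$ exactly one interval has left endpoint $i$; the $i$-th interval is the one with left endpoint $i-1$, written $[i-1,b_i)$. Set $x_i:=b_i-i$. With the Heaviside function $H(x)=1$ if $x\ge 0$ and $H(x)=0$ otherwise, the NIR matrix is the $n\times n$ matrix with $H_G(i,j)=H(x_j+j-i)$ if $i>j$ and $H_G(i,j)=0$ otherwise (so for $i>j$, $H_G(i,j)=1$ iff the $i$-th and $j$-th intervals intersect). A maximal clique is a clique not strictly contained in another clique. -}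

module Defs where

open import Data.Nat as ℕ using (ℕ; zero; suc; _≤_; _<_)
open import Data.Integer as ℤ using (ℤ; +_; _-_)
open import Data.Bool using (Bool; true; false; if_then_else_; _∧_; _∨_)
open import Data.Fin using (Fin; toℕ)
open import Data.Fin.Subset using (Subset; _∈_; _⊆_)
open import Data.Vec using (tabulate)
open import Data.Product using (Σ; ∃; _×_)
open import Data.Sum using (_⊎_)
open import Relation.Nullary using (¬_)
open import Relation.Binary.PropositionalEquality using (_≡_; _≢_)

-- Convention: vertices/rows are Fin n, 0-based.  The element k : Fin n
-- corresponds to the paper's index i = toℕ k + 1, i.e. to the interval
-- [i-1, b_i) = [toℕ k, b k).

-- Interval k is [toℕ k, b k) with integer endpoints, toℕ k < b k ≤ n.
-- (Each left endpoint 0..n-1 occurs exactly once, by construction.)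
record NIR (n : ℕ) : Set where
  field
    b     : Fin n → ℕ
    b-gt  : ∀ k → toℕ k < b k
    b-le  : ∀ k → b k ≤ n
open NIR public

InIco : ℕ → ℕ → ℕ → Set
InIco lo hi m = lo ≤ m × m < hi

_∋ₖ_ : ∀ {n} → NIR n → Fin n → ℕ → Set
(F ∋ₖ k) m = InIco (toℕ k) (b F k) m

Adj : ∀ {n} → NIR n → Fin n → Fin n → Set
Adj F u v = u ≢ v × ∃ λ m → (F ∋ₖ u) m × (F ∋ₖ v) m

IsClique : ∀ {n} → NIR n → Subset n → Set
IsClique F S = ∀ u v → u ∈ S → v ∈ S → u ≢ v → Adj F u v

IsMaximalClique : ∀ {n} → NIR n → Subset n → Set
IsMaximalClique F S =
  IsClique F S × (∀ T → IsClique F T → S ⊆ T → T ≡ S)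

Heaviside : ℤ → ℕ
Heaviside x = if ℤ.+ 0 ℤ.≤ᵇ x then 1 else 0

idx : ∀ {n} → Fin n → ℕ
idx k = suc (toℕ k)

xval : ∀ {n} → NIR n → Fin n → ℤ
xval F j = + b F j - + idx j

HG : ∀ {n} → NIR n → Fin n → Fin n → ℕ
HG F i j =
  if idx j ℕ.<ᵇ idx i
  then Heaviside (xval F j ℤ.+ + idx j - + idx i)
  else 0

Row : ∀ {n} → NIR n → Fin n → Subset n
Row F i = tabulate λ j →
  ((idx j ℕ.<ᵇ idx i) ∧ (HG F i j ℕ.≡ᵇ 1)) ∨ (idx j ℕ.≡ᵇ idx i)

Special : ∀ {n} → NIR n → Fin n → Set
Special {n} F i =
  idx i ≡ n
  ⊎ Σ (Fin n) λ i' → idx i' ≡ suc (idx i)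
      × ∃ λ j → j ∈ Row F i × HG F i' j ≡ 0

{-# OPTIONS --safe #-}
module Submission where

-- Row i is exactly the set of intervals containing the point toℕ i, so it is a
-- clique, and i ∈ Row i makes i ↦ Row i injective.  Every clique S lies in the Row
-- of its member with the largest left endpoint, since that endpoint lies in every
-- interval of S; hence the maximal cliques are the maximal Rows.  If row i is
-- special, its witness interval ends by toℕ i + 1 and so meets no interval starting
-- after i, which forces every clique containing Row i into Row i.  Otherwise
-- Row i ⊆ Row (i+1), so Row i is not maximal.

open import Defs
open import Data.Bool using (T; _∧_; _∨_)
open import Data.Bool.Properties using (T-≡; T-∧; T-∨)
open import Data.Empty using (⊥-elim)
open import Data.Fin as Fin using (Fin; toℕ; fromℕ<)
open import Data.Fin.Properties using (toℕ-injective; toℕ-fromℕ<; toℕ<n; any?)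
open import Data.Fin.Subset using (Subset; _∈_; _⊆_)
open import Data.Fin.Subset.Properties using (_∈?_; ⊆-antisym; nonempty?)
open import Data.Integer using (+_; _+_; _-_; _⊖_)
open import Data.Integer.Properties as Int using (⊖-≥; [1+m]⊖[1+n]≡m⊖n; m-n≡m⊖n)
open import Algebra.Properties.AbelianGroup Int.+-0-abelianGroup using (//-rightDividesˡ)
open import Data.Nat as ℕ using (ℕ; zero; suc; _≤_; _<_; s≤s; z≤n)
open import Data.Nat.Properties
  using (≤-refl; ≤-reflexive; ≤-antisym; ≤-pred; <⇒≤; <-≤-trans; ≤-<-trans; ≰⇒>; ≮⇒≥;
         ≤∧≢⇒<; m≤n⇒m<n∨m≡n; suc-injective; 0≢1+n; 1+n≢n; <⇒<ᵇ; <ᵇ⇒<; ≡⇒≡ᵇ; ≡ᵇ⇒≡)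
open import Data.Product using (Σ; ∃; _×_; _,_; proj₁)
open import Data.Sum using (inj₁; inj₂)
open import Data.Vec.Properties using (lookup∘tabulate; []=⇒lookup; lookup⇒[]=)
open import Function using (_∘_)
open import Function.Bundles using (Equivalence)
open import Relation.Nullary using (yes; no)
open import Relation.Nullary.Decidable using (_×-dec_)
open import Relation.Unary using (Pred; Decidable)
open import Relation.Binary.PropositionalEquality
  using (_≡_; _≢_; refl; sym; trans; cong; subst; module ≡-Reasoning)

open Equivalence using (to; from)

Heaviside-⊖-≥ : ∀ {m s} → s ≤ m → Heaviside (m ⊖ s) ≡ 1
Heaviside-⊖-≥ s≤m rewrite ⊖-≥ s≤m = refl

Heaviside-⊖-< : ∀ {m s} → m < s → Heaviside (m ⊖ s) ≡ 0
Heaviside-⊖-< {zero}  {suc s} _         = refl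
Heaviside-⊖-< {suc m} {suc s} (s≤s m<s) rewrite [1+m]⊖[1+n]≡m⊖n m s = Heaviside-⊖-< m<s

greatest : ∀ {n p} {P : Pred (Fin n) p} → Decidable P → ∃ P →
           ∃ λ m → P m × (∀ {v} → P v → toℕ v ≤ toℕ m)
greatest {suc n} {P = P} P? (u , Pu) with any? (P? ∘ Fin.suc)
... | yes P∘suc-inhabited =
  let (m , Psm , m-greatest) = greatest (P? ∘ Fin.suc) P∘suc-inhabited
  in  Fin.suc m , Psm , λ { {Fin.zero} _ → z≤n ; {Fin.suc v} Psv → s≤s (m-greatest Psv) }
... | no ¬P∘suc =
  Fin.zero , P-zero u Pu , λ { {Fin.zero} _ → z≤n ; {Fin.suc v} Psv → ⊥-elim (¬P∘suc (v , Psv)) }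
  where
  P-zero : ∀ u → P u → P Fin.zero
  P-zero Fin.zero    Pu  = Pu
  P-zero (Fin.suc u) Psu = ⊥-elim (¬P∘suc (u , Psu))

module _ {n : ℕ} (F : NIR n) where

  HG-below : ∀ {i j} → toℕ j < toℕ i → HG F i j ≡ Heaviside (b F j ⊖ idx i)
  HG-below {i} {j} j<i rewrite to T-≡ (<⇒<ᵇ (s≤s j<i)) = cong Heaviside (begin
    xval F j + + idx j - + idx i  ≡⟨ cong (_- + idx i) (//-rightDividesˡ (+ idx j) (+ b F j)) ⟩
    + b F j - + idx i             ≡⟨ m-n≡m⊖n (b F j) (idx i) ⟩
    b F j ⊖ idx i                 ∎)
    where open ≡-Reasoning

  HG≡1 : ∀ {i j} → toℕ j < toℕ i → toℕ i < b F j → HG F i j ≡ 1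
  HG≡1 j<i i<b = trans (HG-below j<i) (Heaviside-⊖-≥ i<b)

  HG≡0 : ∀ {i j} → toℕ j < toℕ i → b F j ≤ toℕ i → HG F i j ≡ 0
  HG≡0 j<i b≤i = trans (HG-below j<i) (Heaviside-⊖-< (s≤s b≤i))

  HG≡1⇒< : ∀ {i j} → toℕ j < toℕ i → HG F i j ≡ 1 → toℕ i < b F j
  HG≡1⇒< j<i HGij≡1 = ≰⇒> (λ b≤i → 0≢1+n (trans (sym (HG≡0 j<i b≤i)) HGij≡1))

  HG≡0⇒≤ : ∀ {i j} → toℕ j < toℕ i → HG F i j ≡ 0 → b F j ≤ toℕ i
  HG≡0⇒≤ j<i HGij≡0 = ≮⇒≥ (λ i<b → 0≢1+n (trans (sym HGij≡0) (HG≡1 j<i i<b)))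

  ∈-Row⁻ : ∀ {i j} → j ∈ Row F i → (F ∋ₖ j) (toℕ i)
  ∈-Row⁻ {j = j} j∈ with to T-∨ (from T-≡ (trans (sym (lookup∘tabulate _ j)) ([]=⇒lookup j∈)))
  ... | inj₁ below =
    let (j<ᵇi , HG≡ᵇ1) = to T-∧ below
        j<i = ≤-pred (<ᵇ⇒< _ _ j<ᵇi)
    in  <⇒≤ j<i , HG≡1⇒< j<i (≡ᵇ⇒≡ _ _ HG≡ᵇ1)
  ... | inj₂ j≡ᵇi =
    let j≡i = suc-injective (≡ᵇ⇒≡ _ _ j≡ᵇi)
    in  ≤-reflexive j≡i , subst (_< b F j) j≡i (b-gt F j)

  ∈-Row⁺ : ∀ {i j} → (F ∋ₖ j) (toℕ i) → j ∈ Row F i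
  ∈-Row⁺ {i} {j} (j≤i , i<b) = lookup⇒[]= j (Row F i) (trans (lookup∘tabulate _ j) (to T-≡ bit))
    where
    bit : T (((idx j ℕ.<ᵇ idx i) ∧ (HG F i j ℕ.≡ᵇ 1)) ∨ (idx j ℕ.≡ᵇ idx i))
    bit with m≤n⇒m<n∨m≡n j≤i
    ... | inj₁ j<i = from T-∨ (inj₁ (from T-∧ (<⇒<ᵇ (s≤s j<i) , ≡⇒≡ᵇ _ _ (HG≡1 j<i i<b))))
    ... | inj₂ j≡i = from T-∨ (inj₂ (≡⇒≡ᵇ _ _ (cong suc j≡i)))

  i∈Row[i] : ∀ i → i ∈ Row F i
  i∈Row[i] i = ∈-Row⁺ (≤-refl , b-gt F i)

  Row-isClique : ∀ i → IsClique F (Row F i)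
  Row-isClique i u v u∈ v∈ u≢v = u≢v , toℕ i , ∈-Row⁻ u∈ , ∈-Row⁻ v∈

  Row-injective : ∀ {i i′} → Row F i ≡ Row F i′ → i ≡ i′
  Row-injective {i} {i′} eq = toℕ-injective (≤-antisym
    (proj₁ (∈-Row⁻ (subst (i ∈_) eq (i∈Row[i] i))))
    (proj₁ (∈-Row⁻ (subst (i′ ∈_) (sym eq) (i∈Row[i] i′)))))

  Adj⇒<b : ∀ {u v} → Adj F u v → toℕ v < b F u
  Adj⇒<b (_ , m , (_ , m<bu) , (v≤m , _)) = ≤-<-trans v≤m m<bu

  clique⊆Row : ∀ {S u} → IsClique F S → u ∈ S → (∀ {v} → v ∈ S → toℕ v ≤ toℕ u) → S ⊆ Row F u
  clique⊆Row {u = u} S-clique u∈S S≤u {v} v∈S = ∈-Row⁺ (S≤u v∈S , u<bv)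
    where
    u<bv : toℕ u < b F v
    u<bv with v Fin.≟ u
    ... | yes refl = b-gt F v
    ... | no  v≢u  = Adj⇒<b (S-clique v u v∈S u∈S v≢u)

  clique⊆some-Row : Fin n → ∀ {S} → IsClique F S → ∃ λ k → S ⊆ Row F k
  clique⊆some-Row k₀ {S} S-clique with nonempty? S
  ... | no  S-empty     = k₀ , λ {v} v∈S → ⊥-elim (S-empty (v , v∈S))
  ... | yes S-inhabited =
    let (m , m∈S , S≤m) = greatest (_∈? S) S-inhabited
    in  m , clique⊆Row S-clique m∈S S≤m

  Special⇒bounds-cliques : ∀ {i S} → Special F i → IsClique F S → Row F i ⊆ S →
                           ∀ {v} → v ∈ S → toℕ v ≤ toℕ i
  Special⇒bounds-cliques (inj₁ i-last) _ _ {v} _ = ≤-pred (subst (toℕ v <_) (sym i-last) (toℕ<n v))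
  Special⇒bounds-cliques {i} (inj₂ (i′ , i′≡1+i , j , j∈Row , HGi′j≡0)) S-clique Row⊆S {v} v∈S
    with v Fin.≟ j
  ... | yes refl = proj₁ (∈-Row⁻ j∈Row)
  ... | no  v≢j  = ≤-pred (<-≤-trans (Adj⇒<b (S-clique j v (Row⊆S j∈Row) v∈S (v≢j ∘ sym))) bj≤1+i)
    where
    j<i′ : toℕ j < toℕ i′
    j<i′ = subst (toℕ j <_) (sym (suc-injective i′≡1+i)) (s≤s (proj₁ (∈-Row⁻ j∈Row)))
    bj≤1+i : b F j ≤ suc (toℕ i)
    bj≤1+i = subst (b F j ≤_) (suc-injective i′≡1+i) (HG≡0⇒≤ j<i′ HGi′j≡0)

  Special⇒maximal : ∀ {i} → Special F i → IsMaximalClique F (Row F i)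
  Special⇒maximal {i} i-special = Row-isClique i , λ S S-clique Row⊆S →
    ⊆-antisym (clique⊆Row S-clique (Row⊆S (i∈Row[i] i)) (Special⇒bounds-cliques i-special S-clique Row⊆S))
              Row⊆S

  Row⊆next : ∀ {k k′} → toℕ k′ ≡ suc (toℕ k) → (∀ {j} → j ∈ Row F k → HG F k′ j ≢ 0) →
             Row F k ⊆ Row F k′
  Row⊆next {k′ = k′} k′≡1+k HG≢0 {j} j∈Row = ∈-Row⁺ (<⇒≤ j<k′ , ≰⇒> (HG≢0 j∈Row ∘ HG≡0 j<k′))
    where
    j<k′ : toℕ j < toℕ k′
    j<k′ = subst (toℕ j <_) (sym k′≡1+k) (s≤s (proj₁ (∈-Row⁻ j∈Row)))

  maximal⇒leaves-next : ∀ {k k′} → IsMaximalClique F (Row F k) → toℕ k′ ≡ suc (toℕ k) →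
                        ∃ λ j → j ∈ Row F k × HG F k′ j ≡ 0
  maximal⇒leaves-next {k} {k′} (_ , Row-maximal) k′≡1+k
    with any? (λ j → (j ∈? Row F k) ×-dec (HG F k′ j ℕ.≟ 0))
  ... | yes leaving = leaving
  ... | no  ∄leaving = ⊥-elim (1+n≢n (trans (sym k′≡1+k) (cong toℕ k′≡k)))
    where
    k′≡k : k′ ≡ k
    k′≡k = Row-injective (Row-maximal (Row F k′) (Row-isClique k′)
                                      (Row⊆next k′≡1+k (λ j∈Row HGk′j≡0 → ∄leaving (_ , j∈Row , HGk′j≡0))))

  maximal⇒Special : ∀ {k} → IsMaximalClique F (Row F k) → Special F k
  maximal⇒Special {k} k-maximal with idx k ℕ.≟ n
  ... | yes k-last    = inj₁ k-last
  ... | no  k-notLast =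
    let 1+k<n = ≤∧≢⇒< (toℕ<n k) k-notLast
        k′≡1+k = toℕ-fromℕ< 1+k<n
    in  inj₂ (fromℕ< 1+k<n , cong suc k′≡1+k , maximal⇒leaves-next k-maximal k′≡1+k)

  maximal⇒special-Row : Fin n → ∀ {S} → IsMaximalClique F S → ∃ λ k → Special F k × Row F k ≡ S
  maximal⇒special-Row k₀ S-maximal@(S-clique , S-max) =
    let (k , S⊆Row) = clique⊆some-Row k₀ S-clique
        Row≡S = S-max (Row F k) (Row-isClique k) S⊆Row
    in  k , maximal⇒Special (subst (IsMaximalClique F) (sym Row≡S) S-maximal) , Row≡S

lemma3 : (n : ℕ) → 1 ≤ n → (F : NIR n) →
         ((i : Fin n) → Special F i → IsMaximalClique F (Row F i))
         × ((i i' : Fin n) → Special F i → Special F i' → Row F i ≡ Row F i' → i ≡ i')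
         × ((S : Subset n) → IsMaximalClique F S → Σ (Fin n) λ i → Special F i × Row F i ≡ S)
lemma3 (suc n) _ F =
    (λ _ → Special⇒maximal F)
  , (λ _ _ _ _ → Row-injective F)
  , (λ _ → maximal⇒special-Row F Fin.zero)
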